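{- Let $a,b,c\in\mathbb{N}$ with $a\le b\le c$, $3a<b+c$ and $2b>c$. Then $f(a,b,c)=\left\lfloor \frac{2}{3}(b+c-1)\right\rfloor$.
   Context: $\mathbb{N}$ denotes the positive integers and $[n]=\{1,\dots,n\}$. For $a,b,c\in\mathbb{N}$, $f(a,b,c)$ denotes the metric dimension of the Cartesian product $K_a\times K_b\times K_c$ of complete graphs (vertex set $[a]\times[b]\times[c]$, two triples adjacent iff they differ in exactly one coordinate); the metric dimension of a graph is the minimum size of a vertex set $U$ such that every vertex is uniquely determined by its vector of distances to the vertices of $U$. Equivalently, $f(a,b,c)$ is the minimum cardinality of a set $Q\subseteq[a]\times[b]\times[c]$ such that for all distinct $s,s'$ there is $q\in Q$ with $g(s,q)\neq g(s',q)$, where $g(s,q)$ is the number of indices $i\in[3]$ with $s_i=q_i$. -}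

module Defs where

open import Data.Nat using (ℕ; _+_; _≤_)
open import Data.Fin using (Fin; _≟_)
open import Data.Product using (_×_; _,_; ∃)
open import Data.List using (List; length)
open import Data.List.Relation.Unary.Any using (Any)
open import Data.List.Relation.Unary.Unique.Propositional using (Unique)
open import Relation.Nullary using (¬_)
open import Relation.Nullary.Decidable using (Dec; yes; no)
open import Relation.Binary.PropositionalEquality using (_≡_; _≢_)

-- Vertex set [a] × [b] × [c] of K_a × K_b × K_c.
Vertex : ℕ → ℕ → ℕ → Set
Vertex a b c = Fin a × Fin b × Fin c

agree : ∀ {n} → Fin n → Fin n → ℕ
agree x y with x ≟ y
... | yes _ = 1
... | no _  = 0

g : ∀ {a b c} → Vertex a b c → Vertex a b c → ℕ
g (s₁ , s₂ , s₃) (q₁ , q₂ , q₃) = agree s₁ q₁ + agree s₂ q₂ + agree s₃ q₃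

Resolving : ∀ {a b c} → List (Vertex a b c) → Set
Resolving {a} {b} {c} Q =
  (s s' : Vertex a b c) → s ≢ s' → Any (λ q → g s q ≢ g s' q) Q

-- f(a,b,c) = k : k is the minimum cardinality of a resolving set
-- (sets represented as duplicate-free lists).
MetricDimEq : ℕ → ℕ → ℕ → ℕ → Set
MetricDimEq a b c k =
  (∃ λ (Q : List (Vertex a b c)) → Unique Q × Resolving Q × length Q ≡ k)
  × ((Q : List (Vertex a b c)) → Unique Q → Resolving Q → k ≤ length Q)

{-# OPTIONS --safe #-}
module Submission where

-- Fix a layer x₀ and look at Q through the b × c grid of the vertices
-- (x₀, y, z), which Q must separate: then at most one row and at most one column of
-- the grid miss Q, at most one point of Q is alone both in its row and in its
-- column, and such a lonely point excludes an empty row together with an empty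
-- column. Charge each point 2 for each of its two lines in which it is alone and 1
-- otherwise: a point costs at most 3 unless it is lonely, and each nonempty line
-- collects at least 2, so 2(b + c) ≤ 3|Q| + 4, i.e. |Q| ≥ ⌊2(b + c − 1)/3⌋.
--
-- Write b = i + 2j + s and c = 2i + j + s with s ∈ {1, 2, 3}; then
-- ⌊2(b + c − 1)/3⌋ = 2(i + j) + e and 3a < b + c says a ≤ i + j + f, where
-- (e, f) = (0, 0), (2, 1), (3, 1) for s = 1, 2, 3. A resolving set of that size that
-- misses a row and a column (a core) is built from certified small ones by gluing
-- gadgets: a pair of points in a new row and two new columns (a row piece), or two or
-- three row pieces on as many new layers, and the same for columns. Pieces on new
-- layers reach the largest a; smaller a are reached by pieces on layer 0. Each gadget
-- is checked once, by computation, on the finitely many cells that classify the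
-- vertices of any glued graph. Gluing needs the empty row and column of the core and,
-- for gadgets with new layers, that no row (resp. column) of the core meets its
-- points exactly where some layer does.

open import Defs
open import Data.Bool using (Bool; true; false; T)
open import Data.Nat using (ℕ; zero; suc; _+_; _*_; _∸_; _/_; _%_; _≤_; _<_; z≤n; s≤s)
  renaming (_≟_ to _≟ℕ_)
open import Data.Nat.Properties hiding (suc-injective)
open import Data.Nat.DivMod using (+-distrib-/; m*n/n≡m; m*n%n≡0; m<n⇒m%n≡m; m<n⇒m/n≡0; m<n*o⇒m/o<n)
open import Data.Nat.Tactic.RingSolver using (solve-∀)
open import Data.Fin using (Fin; zero; suc; #_; fromℕ<; punchIn; punchOut; _↑ˡ_; _↑ʳ_; splitAt)
  renaming (_≟_ to _≟ᶠ_)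
open import Data.Fin.Properties
  using (all?; any?; suc-injective; punchInᵢ≢i; punchIn-punchOut; ↑ˡ-injective; ↑ʳ-injective; splitAt-↑ˡ; splitAt-↑ʳ)
open import Data.Product using (_×_; _,_; proj₁; proj₂; ∃; ∃₂; uncurry)
open import Data.Product.Properties using (≡-dec; ,-injective)
open import Data.Sum using (_⊎_; inj₁; inj₂)
open import Data.Empty using (⊥; ⊥-elim)
open import Data.List using (List; []; _∷_; map; _++_; length; lookup)
open import Data.List.Properties using (length-++; length-map)
open import Data.List.Membership.Propositional using (_∈_)
open import Data.List.Membership.Propositional.Properties using (∈-map⁻)
open import Data.List.Relation.Unary.All as All using (All)
import Data.List.Relation.Unary.All.Properties as Allₚ
open import Data.List.Relation.Unary.Any as Any using (Any)
open import Data.List.Relation.Unary.Any.Properties using (lookup-index)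
open import Data.List.Relation.Unary.Unique.Propositional using (Unique)
import Data.List.Relation.Unary.Unique.Propositional.Properties as Uniqueₚ
import Data.List.Relation.Unary.Unique.DecPropositional as UniqueDec
open import Function using (_∘_)
open import Relation.Nullary using (¬_; Dec; yes; no)
open import Relation.Nullary.Decidable
  using (True; toWitness; from-yes; decidable-stable; map′; ¬?; _×-dec_; _⊎-dec_; _→-dec_; T?)
open import Relation.Binary.PropositionalEquality
open import Algebra.Properties.Semiring.Sum +-*-semiring
  using (sum; sum-syntax; sum-cong-≗; sum-remove; ∑-distrib-+; ∑-comm; *-distribˡ-sum)

module _ {n : ℕ} where

  agree-≡ : {x y : Fin n} → x ≡ y → agree x y ≡ 1
  agree-≡ {x} {y} x≡y with x ≟ᶠ y
  ... | yes _ = refl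
  ... | no x≢y = ⊥-elim (x≢y x≡y)

  agree-≢ : {x y : Fin n} → x ≢ y → agree x y ≡ 0
  agree-≢ {x} {y} x≢y with x ≟ᶠ y
  ... | yes x≡y = ⊥-elim (x≢y x≡y)
  ... | no _ = refl

agree-⇔ : ∀ {m n} {x x' : Fin m} {y y' : Fin n} →
          (x ≡ x' → y ≡ y') → (y ≡ y' → x ≡ x') → agree x x' ≡ agree y y'
agree-⇔ {x = x} {x'} to from with x ≟ᶠ x'
... | yes x≡x' = sym (agree-≡ (to x≡x'))
... | no x≢x' = sym (agree-≢ (x≢x' ∘ from))

↑ˡ≢↑ʳ : ∀ {m n} (i : Fin m) (j : Fin n) → i ↑ˡ n ≢ m ↑ʳ j
↑ˡ≢↑ʳ {m} {n} i j eq with trans (sym (splitAt-↑ˡ m i n)) (trans (cong (splitAt m) eq) (splitAt-↑ʳ m n j))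
... | ()

agree-↑ˡ : ∀ {m} n (i i' : Fin m) → agree (i ↑ˡ n) (i' ↑ˡ n) ≡ agree i i'
agree-↑ˡ n i i' = agree-⇔ (↑ˡ-injective n i i') (cong (_↑ˡ n))

agree-↑ʳ : ∀ m {n} (j j' : Fin n) → agree (m ↑ʳ j) (m ↑ʳ j') ≡ agree j j'
agree-↑ʳ m j j' = agree-⇔ (↑ʳ-injective m j j') (cong (m ↑ʳ_))

agree-↑ˡ↑ʳ : ∀ {m n} (i : Fin m) (j : Fin n) → agree (i ↑ˡ n) (m ↑ʳ j) ≡ 0
agree-↑ˡ↑ʳ i j = agree-≢ (↑ˡ≢↑ʳ i j)

agree-↑ʳ↑ˡ : ∀ {m n} (j : Fin n) (i : Fin m) → agree (m ↑ʳ j) (i ↑ˡ n) ≡ 0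
agree-↑ʳ↑ˡ j i = agree-≢ (↑ˡ≢↑ʳ i j ∘ sym)

agree-suc : ∀ {n} (i j : Fin n) → agree (suc i) (suc j) ≡ agree i j
agree-suc i j = agree-⇔ suc-injective (cong suc)

module _ {a b c : ℕ} where

  layer : Vertex a b c → Fin a
  layer = proj₁

  row : Vertex a b c → Fin b
  row = proj₁ ∘ proj₂

  col : Vertex a b c → Fin c
  col = proj₂ ∘ proj₂

  _≟ᵛ_ : (s t : Vertex a b c) → Dec (s ≡ t)
  _≟ᵛ_ = ≡-dec _≟ᶠ_ (≡-dec _≟ᶠ_ _≟ᶠ_)

  SameSignature : List (Vertex a b c) → Vertex a b c → Vertex a b c → Set
  SameSignature Q s s' = All (λ q → g s q ≡ g s' q) Q

  unique? : (Q : List (Vertex a b c)) → Dec (Unique Q)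
  unique? = UniqueDec.unique? _≟ᵛ_

  sameSignature? : ∀ Q s s' → Dec (SameSignature Q s s')
  sameSignature? Q s s' = All.all? (λ q → g s q ≟ℕ g s' q) Q

  Resolving⇒separates : ∀ {Q} → Resolving Q → ∀ {s s'} → SameSignature Q s s' → s ≡ s'
  Resolving⇒separates {Q} resolving {s} {s'} same with s ≟ᵛ s'
  ... | yes s≡s' = s≡s'
  ... | no s≢s' = ⊥-elim (uncurry (λ eq neq → neq eq) (All.lookupAny same (resolving s s' s≢s')))

  separates⇒Resolving : ∀ {Q} → (∀ {s s'} → SameSignature Q s s' → s ≡ s') → Resolving Q
  separates⇒Resolving {Q} separates s s' s≢s' with Any.any? (λ q → ¬? (g s q ≟ℕ g s' q)) Q
  ... | yes witness = witness
  ... | no none = ⊥-elim (s≢s' (separates (All.map (decidable-stable (g s _ ≟ℕ g s' _)) (Allₚ.¬Any⇒All¬ Q none))))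

  resolving? : (Q : List (Vertex a b c)) → Dec (Resolving Q)
  resolving? Q = map′ (λ h → separates⇒Resolving (h _ _)) (λ r _ _ → Resolving⇒separates r)
    (all-vertices? λ s → all-vertices? λ s' → sameSignature? Q s s' →-dec (s ≟ᵛ s'))
    where
    all-vertices? : {P : Vertex a b c → Set} → (∀ v → Dec (P v)) → Dec (∀ v → P v)
    all-vertices? P? = map′ (λ h (x , y , z) → h x y z) (λ h x y z → h (x , y , z))
      (all? λ x → all? λ y → all? λ z → P? (x , y , z))

x+0≡x : ∀ {x y} → y ≡ 0 → x + y ≡ x
x+0≡x refl = +-identityʳ _

0+x≡x : ∀ {x y} → y ≡ 0 → y + x ≡ x
0+x≡x refl = refl

prefix-+ : ∀ x {y z y' z'} → y + z ≡ y' + z' → x + y + z ≡ x + y' + z'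
prefix-+ x {y} {z} {y'} {z'} eq = trans (+-assoc x y z) (trans (cong (x +_) eq) (sym (+-assoc x y' z')))

x+0+0≡x : ∀ {x y z} → y ≡ 0 → z ≡ 0 → x + y + z ≡ x
x+0+0≡x refl refl = trans (+-identityʳ _) (+-identityʳ _)

sum-mono-≤ : ∀ {n} {f h : Fin n → ℕ} → (∀ i → f i ≤ h i) → sum f ≤ sum h
sum-mono-≤ {zero} f≤h = z≤n
sum-mono-≤ {suc n} f≤h = +-mono-≤ (f≤h zero) (sum-mono-≤ (f≤h ∘ suc))

sum-const : ∀ n k → ∑[ i < n ] k ≡ n * k
sum-const zero k = refl
sum-const (suc n) k = cong (k +_) (sum-const n k)

sum-≥ : ∀ {n} m {f : Fin n → ℕ} → (∀ i → m ≤ f i) → n * m ≤ sum f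
sum-≥ {n} m {f} m≤f = subst (_≤ sum f) (sum-const n m) (sum-mono-≤ m≤f)

term≤sum : ∀ {n} (f : Fin n → ℕ) i → f i ≤ sum f
term≤sum {suc n} f i = subst (f i ≤_) (sym (sum-remove f)) (m≤m+n (f i) _)

two-terms≤sum : ∀ {n} (f : Fin n → ℕ) {i j} → i ≢ j → f i + f j ≤ sum f
two-terms≤sum {suc n} f {i} {j} i≢j = begin
  f i + f j                             ≡⟨ cong (λ k → f i + f k) (sym (punchIn-punchOut i≢j)) ⟩
  f i + f (punchIn i (punchOut i≢j))    ≤⟨ +-monoʳ-≤ (f i) (term≤sum (f ∘ punchIn i) _) ⟩
  f i + sum (f ∘ punchIn i)             ≡⟨ sym (sum-remove f) ⟩
  sum f                                 ∎
  where open ≤-Reasoning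

sum≡0⇒term≡0 : ∀ {n} (f : Fin n → ℕ) {i} → sum f ≡ 0 → f i ≡ 0
sum≡0⇒term≡0 f {i} Σ≡0 = n≤0⇒n≡0 (subst (f i ≤_) Σ≡0 (term≤sum f i))

sum-≥-except : ∀ {n} m (f : Fin (suc n) → ℕ) i₀ → (∀ i → i ≢ i₀ → m ≤ f i) → n * m ≤ sum f
sum-≥-except {n} m f i₀ m≤f = begin
  n * m                        ≤⟨ sum-≥ m (λ i → m≤f (punchIn i₀ i) (punchInᵢ≢i i₀ i)) ⟩
  sum (f ∘ punchIn i₀)         ≤⟨ m≤n+m _ (f i₀) ⟩
  f i₀ + sum (f ∘ punchIn i₀)  ≡⟨ sym (sum-remove f) ⟩
  sum f                        ∎
  where open ≤-Reasoning

sum-indicator : ∀ {n} (f : Fin n → ℕ) x → ∑[ i < n ] (f i * agree i x) ≡ f x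
sum-indicator {suc n} f x = begin
  ∑[ i < suc n ] (f i * agree i x)                                         ≡⟨ sum-remove (λ i → f i * agree i x) ⟩
  f x * agree x x + ∑[ i < n ] (f (punchIn x i) * agree (punchIn x i) x)  ≡⟨ cong₂ _+_ (cong (f x *_) (agree-≡ refl)) (sum-cong-≗ vanish) ⟩
  f x * 1 + ∑[ i < n ] 0                                                   ≡⟨ cong₂ _+_ (*-identityʳ (f x)) (sum-const n 0) ⟩
  f x + n * 0                                                              ≡⟨ x+0≡x (*-zeroʳ n) ⟩
  f x                                                                      ∎
  where
  open ≡-Reasoning
  vanish : ∀ i → f (punchIn x i) * agree (punchIn x i) x ≡ 0
  vanish i = trans (cong (f (punchIn x i) *_) (agree-≢ (punchInᵢ≢i x i))) (*-zeroʳ (f (punchIn x i)))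

sum-by-fibres : ∀ {m n} (key : Fin n → Fin m) (φ : Fin m → ℕ) →
                ∑[ t < n ] φ (key t) ≡ ∑[ y < m ] (φ y * ∑[ t < n ] agree y (key t))
sum-by-fibres {m} {n} key φ = begin
  ∑[ t < n ] φ (key t)                           ≡⟨ sum-cong-≗ (λ t → sym (sum-indicator φ (key t))) ⟩
  ∑[ t < n ] ∑[ y < m ] (φ y * agree y (key t))   ≡⟨ ∑-comm (λ t y → φ y * agree y (key t)) ⟩
  ∑[ y < m ] ∑[ t < n ] (φ y * agree y (key t))   ≡⟨ sum-cong-≗ (λ y → sym (*-distribˡ-sum (φ y) (λ t → agree y (key t)))) ⟩
  ∑[ y < m ] (φ y * ∑[ t < n ] agree y (key t))  ∎
  where open ≡-Reasoning

charge : ℕ → ℕ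
charge 1 = 2
charge _ = 1

charge≤2 : ∀ d → charge d ≤ 2
charge≤2 0 = s≤s z≤n
charge≤2 1 = ≤-refl
charge≤2 (suc (suc d)) = s≤s z≤n

charge≤1 : ∀ {d} → d ≢ 1 → charge d ≤ 1
charge≤1 {0} _ = ≤-refl
charge≤1 {1} d≢1 = ⊥-elim (d≢1 refl)
charge≤1 {suc (suc d)} _ = ≤-refl

2≤charge* : ∀ {d} → d ≢ 0 → 2 ≤ charge d * d
2≤charge* {0} d≢0 = ⊥-elim (d≢0 refl)
2≤charge* {1} _ = ≤-refl
2≤charge* {suc (suc d)} _ = s≤s (s≤s z≤n)

charged-sum : ∀ {m} → (Fin m → ℕ) → ℕ
charged-sum {m} d = ∑[ y < m ] (charge (d y) * d y)

charged-sum-≥ : ∀ {m} (d : Fin m → ℕ) → (∀ y → d y ≢ 0) → m * 2 ≤ charged-sum d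
charged-sum-≥ d d≢0 = sum-≥ 2 (λ y → 2≤charge* (d≢0 y))

charged-sum-≥-one-gap : ∀ {m} (d : Fin m → ℕ) → (∀ {y y'} → d y ≡ 0 → d y' ≡ 0 → y ≡ y') →
                        m * 2 ≤ charged-sum d + 2
charged-sum-≥-one-gap d gap with any? (λ y → d y ≟ℕ 0)
... | no none = ≤-trans (charged-sum-≥ d (λ y dy≡0 → none (y , dy≡0))) (m≤m+n _ 2)
charged-sum-≥-one-gap {suc m} d gap | yes (y₀ , dy₀≡0) = begin
  suc m * 2               ≡⟨ +-comm 2 (m * 2) ⟩
  m * 2 + 2               ≤⟨ +-monoˡ-≤ 2 (sum-≥-except 2 (λ y → charge (d y) * d y) y₀ nonempty) ⟩
  charged-sum d + 2       ∎
  where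
  open ≤-Reasoning
  nonempty : ∀ y → y ≢ y₀ → 2 ≤ charge (d y) * d y
  nonempty y y≢y₀ = 2≤charge* (λ dy≡0 → y≢y₀ (gap dy≡0 dy₀≡0))

module RookCounting {a b c n : ℕ} (q : Fin n → Vertex a b c)
  (separates : ∀ s s' → (∀ t → g s (q t) ≡ g s' (q t)) → s ≡ s')
  (x₀ : Fin a) (y₀ : Fin b) (z₀ : Fin c) where

  rowDegree : Fin b → ℕ
  rowDegree y = ∑[ t < n ] agree y (row (q t))

  colDegree : Fin c → ℕ
  colDegree z = ∑[ t < n ] agree z (col (q t))

  one-empty-row : ∀ {y y'} → rowDegree y ≡ 0 → rowDegree y' ≡ 0 → y ≡ y'
  one-empty-row {y} {y'} empty empty' = cong row (separates (x₀ , y , z₀) (x₀ , y' , z₀) same)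
    where
    same : ∀ t → g (x₀ , y , z₀) (q t) ≡ g (x₀ , y' , z₀) (q t)
    same t = cong (λ e → agree x₀ (layer (q t)) + e + agree z₀ (col (q t)))
      (trans (sum≡0⇒term≡0 (λ u → agree y (row (q u))) empty) (sym (sum≡0⇒term≡0 (λ u → agree y' (row (q u))) empty')))

  one-empty-col : ∀ {z z'} → colDegree z ≡ 0 → colDegree z' ≡ 0 → z ≡ z'
  one-empty-col {z} {z'} empty empty' = cong col (separates (x₀ , y₀ , z) (x₀ , y₀ , z') same)
    where
    same : ∀ t → g (x₀ , y₀ , z) (q t) ≡ g (x₀ , y₀ , z') (q t)
    same t = cong (λ e → agree x₀ (layer (q t)) + agree y₀ (row (q t)) + e)
      (trans (sum≡0⇒term≡0 (λ u → agree z (col (q u))) empty) (sym (sum≡0⇒term≡0 (λ u → agree z' (col (q u))) empty')))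

  alone-in-row : ∀ {y t u} → rowDegree y ≡ 1 → row (q t) ≡ y → row (q u) ≡ y → t ≡ u
  alone-in-row {y} {t} {u} single rt ru with t ≟ᶠ u
  ... | yes t≡u = t≡u
  ... | no t≢u = ⊥-elim (1+n≰n (subst₂ _≤_
    (cong₂ _+_ (agree-≡ (sym rt)) (agree-≡ (sym ru))) single
    (two-terms≤sum (λ v → agree y (row (q v))) t≢u)))

  alone-in-col : ∀ {z t u} → colDegree z ≡ 1 → col (q t) ≡ z → col (q u) ≡ z → t ≡ u
  alone-in-col {z} {t} {u} single ct cu with t ≟ᶠ u
  ... | yes t≡u = t≡u
  ... | no t≢u = ⊥-elim (1+n≰n (subst₂ _≤_
    (cong₂ _+_ (agree-≡ (sym ct)) (agree-≡ (sym cu))) single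
    (two-terms≤sum (λ v → agree z (col (q v))) t≢u)))

  Lonely : Fin n → Set
  Lonely t = rowDegree (row (q t)) ≡ 1 × colDegree (col (q t)) ≡ 1

  lonely-row≡col : ∀ {t} → Lonely t → ∀ u → agree (row (q t)) (row (q u)) ≡ agree (col (q t)) (col (q u))
  lonely-row≡col (rt , ct) u =
    agree-⇔ (λ r → cong (col ∘ q) (alone-in-row rt refl (sym r)))
            (λ c → cong (row ∘ q) (alone-in-col ct refl (sym c)))

  one-lonely : ∀ {t u} → Lonely t → Lonely u → t ≡ u
  one-lonely {t} {u} lt lu =
    alone-in-row (proj₁ lt) refl (sym (cong row (separates (x₀ , row (q t) , col (q u)) (x₀ , row (q u) , col (q t)) swap)))
    where
    swap : ∀ v → g (x₀ , row (q t) , col (q u)) (q v) ≡ g (x₀ , row (q u) , col (q t)) (q v)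
    swap v = begin
      A + agree (row (q t)) (row (q v)) + agree (col (q u)) (col (q v))
        ≡⟨ cong₂ (λ e f → A + e + f) (lonely-row≡col lt v) (sym (lonely-row≡col lu v)) ⟩
      A + agree (col (q t)) (col (q v)) + agree (row (q u)) (row (q v))
        ≡⟨ exchange A _ _ ⟩
      A + agree (row (q u)) (row (q v)) + agree (col (q t)) (col (q v))  ∎
      where
      open ≡-Reasoning
      A = agree x₀ (layer (q v))
      exchange : ∀ x y z → x + y + z ≡ x + z + y
      exchange = solve-∀

  lonely-excludes-gaps : ∀ {t y z} → Lonely t → rowDegree y ≡ 0 → colDegree z ≡ 0 → ⊥
  lonely-excludes-gaps {t} {y} {z} lt empty-y empty-z =
    0≢1+n (trans (sym empty-z) (trans (cong colDegree z≡col) (proj₂ lt)))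
    where
    same : ∀ v → g (x₀ , row (q t) , z) (q v) ≡ g (x₀ , y , col (q t)) (q v)
    same v = begin
      A + agree (row (q t)) (row (q v)) + agree z (col (q v))  ≡⟨ x+0≡x (sum≡0⇒term≡0 (λ u → agree z (col (q u))) empty-z) ⟩
      A + agree (row (q t)) (row (q v))                        ≡⟨ cong (A +_) (lonely-row≡col lt v) ⟩
      A + agree (col (q t)) (col (q v))                        ≡⟨ cong (_+ agree (col (q t)) (col (q v)))
                                                                       (sym (x+0≡x (sum≡0⇒term≡0 (λ u → agree y (row (q u))) empty-y))) ⟩
      A + agree y (row (q v)) + agree (col (q t)) (col (q v))  ∎
      where
      open ≡-Reasoning
      A = agree x₀ (layer (q v))
    z≡col : z ≡ col (q t)
    z≡col = cong col (separates (x₀ , row (q t) , z) (x₀ , y , col (q t)) same)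

  lonely? : ∀ t → Dec (Lonely t)
  lonely? t = (rowDegree (row (q t)) ≟ℕ 1) ×-dec (colDegree (col (q t)) ≟ℕ 1)

  weight : Fin n → ℕ
  weight t = charge (rowDegree (row (q t))) + charge (colDegree (col (q t)))

  weight≤4 : ∀ t → weight t ≤ 4
  weight≤4 t = +-mono-≤ (charge≤2 (rowDegree (row (q t)))) (charge≤2 (colDegree (col (q t))))

  weight≤3 : ∀ t → ¬ Lonely t → weight t ≤ 3
  weight≤3 t not-lonely with rowDegree (row (q t)) ≟ℕ 1
  ... | yes r≡1 = +-mono-≤ (charge≤2 (rowDegree (row (q t)))) (charge≤1 (λ c≡1 → not-lonely (r≡1 , c≡1)))
  ... | no r≢1 = +-mono-≤ (charge≤1 r≢1) (charge≤2 (colDegree (col (q t))))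

  rowCharge colCharge : ℕ
  rowCharge = charged-sum rowDegree
  colCharge = charged-sum colDegree

  total-weight : ∑[ t < n ] weight t ≡ rowCharge + colCharge
  total-weight = trans
    (∑-distrib-+ (λ t → charge (rowDegree (row (q t)))) (λ t → charge (colDegree (col (q t)))))
    (cong₂ _+_ (sum-by-fibres (row ∘ q) (charge ∘ rowDegree)) (sum-by-fibres (col ∘ q) (charge ∘ colDegree)))

  lines≤ : (b + c) * 2 ≤ rowCharge + colCharge + 4
  lines≤ = begin
    (b + c) * 2      ≡⟨ *-distribʳ-+ 2 b c ⟩
    b * 2 + c * 2    ≤⟨ +-mono-≤ (charged-sum-≥-one-gap rowDegree one-empty-row)
                                 (charged-sum-≥-one-gap colDegree one-empty-col) ⟩
    rowCharge + 2 + (colCharge + 2)  ≡⟨ shuffle rowCharge colCharge ⟩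
    rowCharge + colCharge + 4        ∎
    where
    open ≤-Reasoning
    shuffle : ∀ x y → x + 2 + (y + 2) ≡ x + y + 4
    shuffle = solve-∀

  lines≤-with-lonely : ∀ {t} → Lonely t → (b + c) * 2 ≤ rowCharge + colCharge + 2
  lines≤-with-lonely lt with any? (λ y → rowDegree y ≟ℕ 0)
  ... | yes (y , empty) = begin
    (b + c) * 2      ≡⟨ *-distribʳ-+ 2 b c ⟩
    b * 2 + c * 2    ≤⟨ +-mono-≤ (charged-sum-≥-one-gap rowDegree one-empty-row)
                                 (charged-sum-≥ colDegree (λ z → lonely-excludes-gaps lt empty)) ⟩
    rowCharge + 2 + colCharge        ≡⟨ shuffle rowCharge colCharge ⟩
    rowCharge + colCharge + 2        ∎
    where
    open ≤-Reasoning
    shuffle : ∀ x y → x + 2 + y ≡ x + y + 2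
    shuffle = solve-∀
  ... | no none = begin
    (b + c) * 2      ≡⟨ *-distribʳ-+ 2 b c ⟩
    b * 2 + c * 2    ≤⟨ +-mono-≤ (charged-sum-≥ rowDegree (λ y empty → none (y , empty)))
                                 (charged-sum-≥-one-gap colDegree one-empty-col) ⟩
    rowCharge + (colCharge + 2)      ≡⟨ sym (+-assoc rowCharge colCharge 2) ⟩
    rowCharge + colCharge + 2        ∎
    where open ≤-Reasoning

  size-bound : (b + c) * 2 ≤ n * 3 + 4
  size-bound with any? lonely?
  ... | no none = begin
    (b + c) * 2                ≤⟨ lines≤ ⟩
    rowCharge + colCharge + 4  ≡⟨ cong (_+ 4) (sym total-weight) ⟩
    ∑[ t < n ] weight t + 4    ≤⟨ +-monoˡ-≤ 4 (sum-mono-≤ (λ t → weight≤3 t (λ lt → none (t , lt)))) ⟩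
    ∑[ t < n ] 3 + 4           ≡⟨ cong (_+ 4) (sum-const n 3) ⟩
    n * 3 + 4                  ∎
    where open ≤-Reasoning
  ... | yes (t₀ , lt₀) = begin
    (b + c) * 2                                    ≤⟨ lines≤-with-lonely lt₀ ⟩
    rowCharge + colCharge + 2                      ≡⟨ cong (_+ 2) (sym total-weight) ⟩
    ∑[ t < n ] weight t + 2                        ≤⟨ +-monoˡ-≤ 2 (sum-mono-≤ weight≤3+[t≡t₀]) ⟩
    ∑[ t < n ] (3 + agree t t₀) + 2                ≡⟨ cong (_+ 2) (∑-distrib-+ (λ _ → 3) (λ t → agree t t₀)) ⟩
    ∑[ t < n ] 3 + ∑[ t < n ] agree t t₀ + 2       ≡⟨ cong₂ (λ e f → e + f + 2) (sum-const n 3) one-term ⟩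
    n * 3 + 1 + 2                                  ≡⟨ +-assoc (n * 3) 1 2 ⟩
    n * 3 + 3                                      ≤⟨ +-monoʳ-≤ (n * 3) (n≤1+n 3) ⟩
    n * 3 + 4                                      ∎
    where
    open ≤-Reasoning
    weight≤3+[t≡t₀] : ∀ t → weight t ≤ 3 + agree t t₀
    weight≤3+[t≡t₀] t with lonely? t
    ... | yes lt = subst (λ e → weight t ≤ 3 + e) (sym (agree-≡ (one-lonely lt lt₀))) (weight≤4 t)
    ... | no not-lonely = ≤-trans (weight≤3 t not-lonely) (m≤m+n 3 _)
    one-term : ∑[ t < n ] agree t t₀ ≡ 1
    one-term = trans (sum-cong-≗ (λ t → sym (*-identityˡ (agree t t₀)))) (sum-indicator (λ _ → 1) t₀)

lookup-separates : ∀ {a b c} {Q : List (Vertex a b c)} → Resolving Q →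
                   ∀ s s' → (∀ t → g s (lookup Q t) ≡ g s' (lookup Q t)) → s ≡ s'
lookup-separates resolving s s' same = Resolving⇒separates resolving
  (All.tabulate λ q∈Q → subst (λ q → g s q ≡ g s' q) (sym (lookup-index q∈Q)) (same (Any.index q∈Q)))

resolving-length-bound : ∀ {a b c} → Vertex a b c → ∀ {Q} → Resolving Q → (b + c) * 2 ≤ length Q * 3 + 4
resolving-length-bound (x₀ , y₀ , z₀) {Q} resolving =
  RookCounting.size-bound (lookup Q) (lookup-separates resolving) x₀ y₀ z₀

m*2≤n*3+4⇒[2*[m∸1]]/3≤n : ∀ m n → m * 2 ≤ n * 3 + 4 → (2 * (m ∸ 1)) / 3 ≤ n
m*2≤n*3+4⇒[2*[m∸1]]/3≤n zero n _ = z≤n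
m*2≤n*3+4⇒[2*[m∸1]]/3≤n (suc m) n bound = ≤-pred (m<n*o⇒m/o<n {2 * m} {suc n} (begin-strict
  2 * m                 <⟨ s≤s (+-cancelˡ-≤ 2 (2 * m) (n * 3 + 2) (subst₂ _≤_ (lhs m) (rhs n) bound)) ⟩
  suc (n * 3 + 2)       ≡⟨ top n ⟩
  suc n * 3             ∎))
  where
  open ≤-Reasoning
  lhs : ∀ m → suc m * 2 ≡ 2 + 2 * m
  lhs = solve-∀
  rhs : ∀ n → n * 3 + 4 ≡ 2 + (n * 3 + 2)
  rhs = solve-∀
  top : ∀ n → suc (n * 3 + 2) ≡ suc n * 3
  top = solve-∀

lower-bound : ∀ {a b c} → Vertex a b c → ∀ {Q} → Resolving Q → (2 * (b + c ∸ 1)) / 3 ≤ length Q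
lower-bound {b = b} {c} v {Q} resolving =
  m*2≤n*3+4⇒[2*[m∸1]]/3≤n (b + c) (length Q) (resolving-length-bound v resolving)

record Core (a b c k : ℕ) : Set where
  field
    points : List (Vertex a b c)
    unique : Unique points
    resolving : Resolving points
    size : length points ≡ k
    emptyRow : Fin b
    emptyCol : Fin c
    avoidsRow : All (λ q → row q ≢ emptyRow) points
    avoidsCol : All (λ q → col q ≢ emptyCol) points

module _ {a b c : ℕ} where

  RowsApart ColsApart : List (Vertex a b c) → Set
  RowsApart Q = ∀ y x → ¬ All (λ q → agree y (row q) ≡ agree x (layer q)) Q
  ColsApart Q = ∀ z x → ¬ All (λ q → agree z (col q) ≡ agree x (layer q)) Q

  rowsApart? : (Q : List (Vertex a b c)) → Dec (RowsApart Q)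
  rowsApart? Q = all? λ y → all? λ x → ¬? (All.all? (λ q → agree y (row q) ≟ℕ agree x (layer q)) Q)

  colsApart? : (Q : List (Vertex a b c)) → Dec (ColsApart Q)
  colsApart? Q = all? λ z → all? λ x → ¬? (All.all? (λ q → agree z (col q) ≟ℕ agree x (layer q)) Q)

record Flagged (rowsApart colsApart : Bool) (a b c k : ℕ) : Set where
  field
    core : Core a b c k
    rows-apart : T rowsApart → RowsApart (Core.points core)
    cols-apart : T colsApart → ColsApart (Core.points core)

-- The points of a gadget lie in new rows and columns; their layer 0 is the old layer 0
-- and layer 1 + i is new layer i.
record Gadget : Set where
  field
    newLayers newRows newCols : ℕ
    points : List (Vertex (suc newLayers) newRows newCols)
    needsRowsApart needsColsApart : Bool

module GadgetConditions (G : Gadget) where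
  open Gadget G renaming (newLayers to p; newRows to q; newCols to r)

  -- A cell classifies the vertices of the glued graph: layer 0 stands for the old layers
  -- other than layer 0, layer 1 for old layer 0 and 2 + i for new layer i; row and
  -- column 0 stand for the old lines.
  Cell : Set
  Cell = Vertex (2 + p) (suc q) (suc r)

  embed : Vertex (suc p) q r → Cell
  embed (x , y , z) = suc x , suc y , suc z

  cells : List Cell
  cells = map embed points

  -- cells in a new and in an old layer that the gadget cannot tell apart must have
  -- shapes that the flags of the core separate
  Separable : Fin (suc q) → Fin (suc r) → Fin (suc q) → Fin (suc r) → Set
  Separable y z y' z' =
    y' ≢ zero × z' ≢ zero × ((T needsRowsApart × z ≢ zero) ⊎ (T needsColsApart × y ≢ zero))

  record Valid : Set where
    field
      unique : Unique points
      old-separated : ∀ (k : Fin 2) y y' z z' →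
        SameSignature cells (k ↑ˡ p , y , z) (k ↑ˡ p , y' , z') → y ≡ y' × z ≡ z'
      new-separated : ∀ (i i' : Fin p) y y' z z' →
        SameSignature cells (2 ↑ʳ i , y , z) (2 ↑ʳ i' , y' , z') → i ≡ i' × y ≡ y' × z ≡ z'
      mixed-separable : ∀ (i : Fin p) (k : Fin 2) y y' z z' →
        SameSignature cells (2 ↑ʳ i , y , z) (k ↑ˡ p , y' , z') → Separable y z y' z'
      new-rows-apart : ∀ (i : Fin p) y → ¬ All (λ n → agree y (row n) ≡ agree (2 ↑ʳ i) (layer n)) cells
      new-cols-apart : ∀ (i : Fin p) z → ¬ All (λ n → agree z (col n) ≡ agree (2 ↑ʳ i) (layer n)) cells

  valid? : Dec Valid
  valid? = map′
    (λ (u , o , n , m , rs , cs) → record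
      { unique = u ; old-separated = o ; new-separated = n ; mixed-separable = m
      ; new-rows-apart = rs ; new-cols-apart = cs })
    (λ v → let open Valid v in
      unique , old-separated , new-separated , mixed-separable , new-rows-apart , new-cols-apart)
    (unique? points
      ×-dec (all? λ k → all? λ y → all? λ y' → all? λ z → all? λ z' →
               sameSignature? cells (k ↑ˡ p , y , z) (k ↑ˡ p , y' , z') →-dec (y ≟ᶠ y' ×-dec z ≟ᶠ z'))
      ×-dec (all? λ i → all? λ i' → all? λ y → all? λ y' → all? λ z → all? λ z' →
               sameSignature? cells (2 ↑ʳ i , y , z) (2 ↑ʳ i' , y' , z') →-dec (i ≟ᶠ i' ×-dec y ≟ᶠ y' ×-dec z ≟ᶠ z'))
      ×-dec (all? λ i → all? λ k → all? λ y → all? λ y' → all? λ z → all? λ z' →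
               sameSignature? cells (2 ↑ʳ i , y , z) (k ↑ˡ p , y' , z') →-dec separable? y z y' z')
      ×-dec (all? λ i → all? λ y → ¬? (All.all? (λ n → agree y (row n) ≟ℕ agree (2 ↑ʳ i) (layer n)) cells))
      ×-dec (all? λ i → all? λ z → ¬? (All.all? (λ n → agree z (col n) ≟ℕ agree (2 ↑ʳ i) (layer n)) cells)))
    where
    separable? : ∀ y z y' z' → Dec (Separable y z y' z')
    separable? y z y' z' = ¬? (y' ≟ᶠ zero) ×-dec ¬? (z' ≟ᶠ zero)
      ×-dec ((T? needsRowsApart ×-dec ¬? (z ≟ᶠ zero)) ⊎-dec (T? needsColsApart ×-dec ¬? (y ≟ᶠ zero)))

data Split (m n : ℕ) : Fin (m + n) → Set where
  left  : (i : Fin m) → Split m n (i ↑ˡ n)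
  right : (j : Fin n) → Split m n (m ↑ʳ j)

split : ∀ m {n} x → Split m n x
split zero x = right x
split (suc m) zero = left zero
split (suc m) (suc x) with split m x
... | left i = left (suc i)
... | right j = right j

lineKind : ∀ {m n y} → Split m n y → Fin (suc m)
lineKind (left i) = suc i
lineKind (right _) = zero

shadow : ∀ {m n y} → Fin n → Split m n y → Fin n
shadow w₀ (left _) = w₀
shadow w₀ (right j) = j

shadow-new : ∀ {m n y} {w₀ : Fin n} (v : Split m n y) → lineKind v ≢ zero → shadow w₀ v ≡ w₀
shadow-new (left i) _ = refl
shadow-new (right j) old≢zero = ⊥-elim (old≢zero refl)

split-injective : ∀ {m n y y'} {w₀ : Fin n} (v : Split m n y) (v' : Split m n y') →
                  lineKind v ≡ lineKind v' → shadow w₀ v ≡ shadow w₀ v' → y ≡ y'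
split-injective {n = n} (left i) (left i') kinds _ = cong (_↑ˡ n) (suc-injective kinds)
split-injective {m = m} (right j) (right j') _ shadows = cong (m ↑ʳ_) shadows

agree-shadow-new : ∀ {m n y} {w₀ w : Fin n} (v : Split m n y) → lineKind v ≢ zero → w ≢ w₀ →
                   agree (shadow w₀ v) w ≡ 0
agree-shadow-new v new w≢w₀ = agree-≢ (λ eq → w≢w₀ (trans (sym eq) (shadow-new v new)))

agree-new-line : ∀ {m n y} (v : Split m n y) (i : Fin m) → agree y (i ↑ˡ n) ≡ agree (lineKind v) (suc i)
agree-new-line {n = n} (left i') i = trans (agree-↑ˡ n i' i) (sym (agree-suc i' i))
agree-new-line (right j) i = trans (agree-↑ʳ↑ˡ j i) (sym (agree-≢ {x = zero} {suc i} λ ()))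

agree-old-line : ∀ {m n y} (v : Split m n y) {w₀ w : Fin n} → w ≢ w₀ →
                 agree y (m ↑ʳ w) ≡ agree (shadow w₀ v) w
agree-old-line (left i) w≢w₀ = trans (agree-↑ˡ↑ʳ i _) (sym (agree-≢ (w≢w₀ ∘ sym)))
agree-old-line {m = m} (right j) _ = agree-↑ʳ m j _

module Gluing (G : Gadget) (valid : GadgetConditions.Valid G) {A B C k : ℕ} (K : Core (suc A) B C k)
  (rows-apart : T (Gadget.needsRowsApart G) → RowsApart (Core.points K))
  (cols-apart : T (Gadget.needsColsApart G) → ColsApart (Core.points K)) where

  open Gadget G renaming (newLayers to p; newRows to q; newCols to r; points to N)
  open GadgetConditions G
  open Valid valid renaming (unique to unique-points)
  open Core K renaming (points to Q; emptyRow to r₀; emptyCol to c₀)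

  Vertex′ : Set
  Vertex′ = Vertex (p + suc A) (q + B) (r + C)

  liftLayer : Fin (suc p) → Fin (p + suc A)
  liftLayer zero = p ↑ʳ zero
  liftLayer (suc i) = i ↑ˡ suc A

  lift : Vertex (suc p) q r → Vertex′
  lift (x , y , z) = liftLayer x , y ↑ˡ B , z ↑ˡ C

  keep : Vertex (suc A) B C → Vertex′
  keep (x , y , z) = p ↑ʳ x , q ↑ʳ y , r ↑ʳ z

  points′ : List Vertex′
  points′ = map lift N ++ map keep Q

  oldKind : Fin (suc A) → Fin 2
  oldKind zero = suc zero
  oldKind (suc _) = zero

  layerKind : ∀ {x} → Split p (suc A) x → Fin (2 + p)
  layerKind (left i) = 2 ↑ʳ i
  layerKind (right j) = oldKind j ↑ˡ p

  oldLayerAgree : ∀ {x} → Split p (suc A) x → Fin (suc A) → ℕ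
  oldLayerAgree (left _) _ = 0
  oldLayerAgree (right j) w = agree j w

  agree-lifted-layer : ∀ {x} (v : Split p (suc A) x) l → agree x (liftLayer l) ≡ agree (layerKind v) (suc l)
  agree-lifted-layer (left i) zero = agree-↑ˡ↑ʳ i zero
  agree-lifted-layer (left i) (suc l) =
    trans (agree-↑ˡ (suc A) i l) (sym (trans (agree-suc (suc i) (suc l)) (agree-suc i l)))
  agree-lifted-layer (right zero) zero = agree-≡ refl
  agree-lifted-layer (right zero) (suc l) = agree-↑ʳ↑ˡ zero l
  agree-lifted-layer (right (suc j)) zero = agree-↑ʳ p (suc j) zero
  agree-lifted-layer (right (suc j)) (suc l) = agree-↑ʳ↑ˡ (suc j) l

  agree-kept-layer : ∀ {x} (v : Split p (suc A) x) w → agree x (p ↑ʳ w) ≡ oldLayerAgree v w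
  agree-kept-layer (left i) w = agree-↑ˡ↑ʳ i w
  agree-kept-layer (right j) w = agree-↑ʳ p j w

  kind : ∀ {x y z} → Split p (suc A) x → Split q B y → Split r C z → Cell
  kind vx vy vz = layerKind vx , lineKind vy , lineKind vz

  g-lift : ∀ {x y z} (vx : Split p (suc A) x) (vy : Split q B y) (vz : Split r C z) n →
           g (x , y , z) (lift n) ≡ g (kind vx vy vz) (embed n)
  g-lift vx vy vz (l , i , j) =
    cong₂ _+_ (cong₂ _+_ (agree-lifted-layer vx l) (agree-new-line vy i)) (agree-new-line vz j)

  -- The old points see a new line as the empty line of the core, and no new layer.
  shadowSignature : ∀ {x y z} → Split p (suc A) x → Split q B y → Split r C z → Vertex (suc A) B C → ℕ
  shadowSignature vx vy vz t = oldLayerAgree vx (layer t) + agree (shadow r₀ vy) (row t) + agree (shadow c₀ vz) (col t)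

  g-keep : ∀ {x y z} (vx : Split p (suc A) x) (vy : Split q B y) (vz : Split r C z) {t} →
           row t ≢ r₀ → col t ≢ c₀ → g (x , y , z) (keep t) ≡ shadowSignature vx vy vz t
  g-keep vx vy vz {t} r≢ c≢ =
    cong₂ _+_ (cong₂ _+_ (agree-kept-layer vx (layer t)) (agree-old-line vy r≢)) (agree-old-line vz c≢)

  SameShadowSignature : ∀ {x y z x' y' z'} → Split p (suc A) x → Split q B y → Split r C z →
                        Split p (suc A) x' → Split q B y' → Split r C z' → Set
  SameShadowSignature vx vy vz vx' vy' vz' = All (λ t → shadowSignature vx vy vz t ≡ shadowSignature vx' vy' vz' t) Q

  new-old-impossible : ∀ {y z y' z'} (i : Fin p) (vy : Split q B y) (vz : Split r C z)
                       (j : Fin (suc A)) (vy' : Split q B y') (vz' : Split r C z') →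
                       SameSignature cells (kind (left i) vy vz) (kind (right j) vy' vz') →
                       SameShadowSignature (left i) vy vz (right j) vy' vz' → ⊥
  new-old-impossible i vy vz j vy' vz' same-kind same-shadow
    with mixed-separable i (oldKind j) (lineKind vy) (lineKind vy') (lineKind vz) (lineKind vz') same-kind
  ... | y'-new , z'-new , inj₁ (needs , z-new) =
    rows-apart needs (shadow r₀ vy) j (All.zipWith row-matches (same-shadow , All.zip (avoidsRow , avoidsCol)))
    where
    row-matches : ∀ {t} → _ × (row t ≢ r₀ × col t ≢ c₀) → agree (shadow r₀ vy) (row t) ≡ agree j (layer t)
    row-matches (eq , r≢ , c≢) = trans (sym (x+0≡x (agree-shadow-new vz z-new c≢)))
      (trans eq (x+0+0≡x (agree-shadow-new vy' y'-new r≢) (agree-shadow-new vz' z'-new c≢)))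
  ... | y'-new , z'-new , inj₂ (needs , y-new) =
    cols-apart needs (shadow c₀ vz) j (All.zipWith col-matches (same-shadow , All.zip (avoidsRow , avoidsCol)))
    where
    col-matches : ∀ {t} → _ × (row t ≢ r₀ × col t ≢ c₀) → agree (shadow c₀ vz) (col t) ≡ agree j (layer t)
    col-matches (eq , r≢ , c≢) = trans (sym (0+x≡x (agree-shadow-new vy y-new r≢)))
      (trans eq (x+0+0≡x (agree-shadow-new vy' y'-new r≢) (agree-shadow-new vz' z'-new c≢)))

  -- A vertex is recovered from its cell, seen by the gadget points, and its shadow,
  -- seen by the old points.
  recover : ∀ {x y z x' y' z'}
            (vx : Split p (suc A) x) (vy : Split q B y) (vz : Split r C z)
            (vx' : Split p (suc A) x') (vy' : Split q B y') (vz' : Split r C z') →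
            SameSignature cells (kind vx vy vz) (kind vx' vy' vz') → SameShadowSignature vx vy vz vx' vy' vz' →
            (x , y , z) ≡ (x' , y' , z')
  recover (right j) vy vz (right j') vy' vz' same-kind same-shadow
    with ,-injective (Resolving⇒separates resolving
           {j , shadow r₀ vy , shadow c₀ vz} {j' , shadow r₀ vy' , shadow c₀ vz'} same-shadow)
  ... | refl , same-shadows =
    let same-ky , same-kz = old-separated (oldKind j) _ _ _ _ same-kind
        same-ŷ , same-ẑ = ,-injective same-shadows
    in cong (p ↑ʳ j ,_) (cong₂ _,_ (split-injective vy vy' same-ky same-ŷ) (split-injective vz vz' same-kz same-ẑ))
  recover (left i) vy vz (left i') vy' vz' same-kind same-shadow
    with new-separated i i' _ _ _ _ same-kind
       | ,-injective (Resolving⇒separates resolving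
           {zero , shadow r₀ vy , shadow c₀ vz} {zero , shadow r₀ vy' , shadow c₀ vz'}
           (All.map (λ {t} → prefix-+ (agree zero (layer t))) same-shadow))
  ... | refl , same-ky , same-kz | _ , same-shadows =
    let same-ŷ , same-ẑ = ,-injective same-shadows
    in cong (i ↑ˡ suc A ,_) (cong₂ _,_ (split-injective vy vy' same-ky same-ŷ) (split-injective vz vz' same-kz same-ẑ))
  recover (left i) vy vz (right j) vy' vz' same-kind same-shadow =
    ⊥-elim (new-old-impossible i vy vz j vy' vz' same-kind same-shadow)
  recover (right j) vy vz (left i) vy' vz' same-kind same-shadow =
    ⊥-elim (new-old-impossible i vy' vz' j vy vz (All.map sym same-kind) (All.map sym same-shadow))

  separates′ : ∀ {s s'} → SameSignature points′ s s' → s ≡ s'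
  separates′ {x , y , z} {x' , y' , z'} same =
    recover vx vy vz vx' vy' vz'
      (Allₚ.map⁺ (All.map (λ {n} e → trans (sym (g-lift vx vy vz n)) (trans e (g-lift vx' vy' vz' n)))
                          (Allₚ.map⁻ (proj₁ parts))))
      (All.zipWith (λ (e , r≢ , c≢) → trans (sym (g-keep vx vy vz r≢ c≢)) (trans e (g-keep vx' vy' vz' r≢ c≢)))
                   (Allₚ.map⁻ (proj₂ parts) , All.zip (avoidsRow , avoidsCol)))
    where
    vx = split p x
    vy = split q y
    vz = split r z
    vx' = split p x'
    vy' = split q y'
    vz' = split r z'
    parts = Allₚ.++⁻ (map lift N) same

  liftLayer-injective : ∀ {l l'} → liftLayer l ≡ liftLayer l' → l ≡ l'
  liftLayer-injective {zero} {zero} _ = refl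
  liftLayer-injective {zero} {suc l'} eq = ⊥-elim (↑ˡ≢↑ʳ l' zero (sym eq))
  liftLayer-injective {suc l} {zero} eq = ⊥-elim (↑ˡ≢↑ʳ l zero eq)
  liftLayer-injective {suc l} {suc l'} eq = cong suc (↑ˡ-injective (suc A) l l' eq)

  lift-injective : ∀ {n n'} → lift n ≡ lift n' → n ≡ n'
  lift-injective {_ , y , z} {_ , y' , z'} eq =
    let ex , eyz = ,-injective eq
        ey , ez = ,-injective eyz
    in cong₂ _,_ (liftLayer-injective ex) (cong₂ _,_ (↑ˡ-injective B y y' ey) (↑ˡ-injective C z z' ez))

  keep-injective : ∀ {t t'} → keep t ≡ keep t' → t ≡ t'
  keep-injective {x , y , z} {x' , y' , z'} eq =
    let ex , eyz = ,-injective eq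
        ey , ez = ,-injective eyz
    in cong₂ _,_ (↑ʳ-injective p x x' ex) (cong₂ _,_ (↑ʳ-injective q y y' ey) (↑ʳ-injective r z z' ez))

  unique′ : Unique points′
  unique′ = Uniqueₚ.++⁺ (Uniqueₚ.map⁺ lift-injective unique-points) (Uniqueₚ.map⁺ keep-injective unique) disjoint
    where
    disjoint : ∀ {v} → ¬ (v ∈ map lift N × v ∈ map keep Q)
    disjoint (v∈new , v∈old) with ∈-map⁻ lift v∈new | ∈-map⁻ keep v∈old
    ... | (_ , y , _) , _ , refl | (_ , y' , _) , _ , eq = ↑ˡ≢↑ʳ y y' (proj₁ (,-injective (proj₂ (,-injective eq))))

  avoidsRow′ : All (λ t → row t ≢ q ↑ʳ r₀) points′
  avoidsRow′ = Allₚ.++⁺ (Allₚ.map⁺ (All.tabulate λ {n} _ → ↑ˡ≢↑ʳ (row n) r₀))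
                        (Allₚ.map⁺ (All.map (λ r≢ eq → r≢ (↑ʳ-injective q _ _ eq)) avoidsRow))

  avoidsCol′ : All (λ t → col t ≢ r ↑ʳ c₀) points′
  avoidsCol′ = Allₚ.++⁺ (Allₚ.map⁺ (All.tabulate λ {n} _ → ↑ˡ≢↑ʳ (col n) c₀))
                        (Allₚ.map⁺ (All.map (λ c≢ eq → c≢ (↑ʳ-injective r _ _ eq)) avoidsCol))

  size′ : length points′ ≡ length N + k
  size′ = trans (length-++ (map lift N)) (cong₂ _+_ (length-map lift N) (trans (length-map keep Q) size))

  glued-core : Core (p + suc A) (q + B) (r + C) (length N + k)
  glued-core = record
    { points = points′
    ; unique = unique′
    ; resolving = separates⇒Resolving separates′
    ; size = size′
    ; emptyRow = q ↑ʳ r₀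
    ; emptyCol = r ↑ʳ c₀
    ; avoidsRow = avoidsRow′
    ; avoidsCol = avoidsCol′
    }

  rows-apart′ : RowsApart Q → RowsApart points′
  rows-apart′ apart y x matches = apart′ (split p x) (split q y) matches
    where
    apart′ : ∀ {x y} → Split p (suc A) x → Split q B y →
             ¬ All (λ t → agree y (row t) ≡ agree x (layer t)) points′
    apart′ (right j) vy matches = apart (shadow r₀ vy) j
      (All.zipWith (λ {t} (eq , r≢) → trans (sym (agree-old-line vy r≢)) (trans eq (agree-↑ʳ p j (layer t))))
                   (Allₚ.map⁻ (proj₂ (Allₚ.++⁻ (map lift N) matches)) , avoidsRow))
    apart′ (left i) vy matches = new-rows-apart i (lineKind vy)
      (Allₚ.map⁺ (All.map (λ {n} eq → trans (sym (agree-new-line vy (row n))) (trans eq (agree-lifted-layer (left i) (layer n))))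
                          (Allₚ.map⁻ (proj₁ (Allₚ.++⁻ (map lift N) matches)))))

  cols-apart′ : ColsApart Q → ColsApart points′
  cols-apart′ apart z x matches = apart′ (split p x) (split r z) matches
    where
    apart′ : ∀ {x z} → Split p (suc A) x → Split r C z →
             ¬ All (λ t → agree z (col t) ≡ agree x (layer t)) points′
    apart′ (right j) vz matches = apart (shadow c₀ vz) j
      (All.zipWith (λ {t} (eq , c≢) → trans (sym (agree-old-line vz c≢)) (trans eq (agree-↑ʳ p j (layer t))))
                   (Allₚ.map⁻ (proj₂ (Allₚ.++⁻ (map lift N) matches)) , avoidsCol))
    apart′ (left i) vz matches = new-cols-apart i (lineKind vz)
      (Allₚ.map⁺ (All.map (λ {n} eq → trans (sym (agree-new-line vz (col n))) (trans eq (agree-lifted-layer (left i) (layer n))))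
                          (Allₚ.map⁻ (proj₁ (Allₚ.++⁻ (map lift N) matches)))))

glue : ∀ {fr fc A B C k} (G : Gadget) → GadgetConditions.Valid G →
       (T (Gadget.needsRowsApart G) → T fr) → (T (Gadget.needsColsApart G) → T fc) →
       Flagged fr fc (suc A) B C k →
       Flagged fr fc (Gadget.newLayers G + suc A) (Gadget.newRows G + B) (Gadget.newCols G + C) (length (Gadget.points G) + k)
glue G valid needs-fr needs-fc K = record
  { core = glued-core
  ; rows-apart = rows-apart′ ∘ rows-apart
  ; cols-apart = cols-apart′ ∘ cols-apart
  }
  where
  open Flagged K
  open Gluing G valid core (rows-apart ∘ needs-fr) (cols-apart ∘ needs-fc)

module _ {a b c : ℕ} where

  Certified : Bool → Bool → List (Vertex a (suc b) (suc c)) → Set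
  Certified fr fc Q = Unique Q × Resolving Q × All (λ q → row q ≢ zero) Q × All (λ q → col q ≢ zero) Q
                      × (T fr → RowsApart Q) × (T fc → ColsApart Q)

  certified? : ∀ fr fc Q → Dec (Certified fr fc Q)
  certified? fr fc Q = unique? Q ×-dec resolving? Q
    ×-dec All.all? (λ q → ¬? (row q ≟ᶠ zero)) Q ×-dec All.all? (λ q → ¬? (col q ≟ᶠ zero)) Q
    ×-dec (T? fr →-dec rowsApart? Q) ×-dec (T? fc →-dec colsApart? Q)

  certified-core : ∀ fr fc (Q : List (Vertex a (suc b) (suc c))) {_ : True (certified? fr fc Q)} →
                   Flagged fr fc a (suc b) (suc c) (length Q)
  certified-core fr fc Q {certificate} with toWitness certificate
  ... | unique , resolving , avoidsRow , avoidsCol , rows-apart , cols-apart = record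
    { core = record
      { points = Q ; unique = unique ; resolving = resolving ; size = refl
      ; emptyRow = zero ; emptyCol = zero ; avoidsRow = avoidsRow ; avoidsCol = avoidsCol }
    ; rows-apart = rows-apart
    ; cols-apart = cols-apart
    }

rowPiece colPiece rowPieces₂ colPieces₂ rowPieces₃ colPieces₃ : Gadget
rowPiece = record
  { newLayers = 0 ; newRows = 1 ; newCols = 2
  ; points = (# 0 , # 0 , # 0) ∷ (# 0 , # 0 , # 1) ∷ []
  ; needsRowsApart = false ; needsColsApart = false }
colPiece = record
  { newLayers = 0 ; newRows = 2 ; newCols = 1
  ; points = (# 0 , # 0 , # 0) ∷ (# 0 , # 1 , # 0) ∷ []
  ; needsRowsApart = false ; needsColsApart = false }
rowPieces₂ = record
  { newLayers = 2 ; newRows = 2 ; newCols = 4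
  ; points = (# 1 , # 0 , # 0) ∷ (# 1 , # 1 , # 1) ∷ (# 2 , # 0 , # 2) ∷ (# 2 , # 1 , # 3) ∷ []
  ; needsRowsApart = true ; needsColsApart = false }
colPieces₂ = record
  { newLayers = 2 ; newRows = 4 ; newCols = 2
  ; points = (# 1 , # 0 , # 0) ∷ (# 1 , # 1 , # 1) ∷ (# 2 , # 2 , # 0) ∷ (# 2 , # 3 , # 1) ∷ []
  ; needsRowsApart = false ; needsColsApart = true }
rowPieces₃ = record
  { newLayers = 3 ; newRows = 3 ; newCols = 6
  ; points = (# 1 , # 0 , # 0) ∷ (# 2 , # 0 , # 1) ∷ (# 1 , # 1 , # 2) ∷ (# 3 , # 1 , # 3)
           ∷ (# 2 , # 2 , # 4) ∷ (# 3 , # 2 , # 5) ∷ []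
  ; needsRowsApart = true ; needsColsApart = false }
colPieces₃ = record
  { newLayers = 3 ; newRows = 6 ; newCols = 3
  ; points = (# 1 , # 0 , # 0) ∷ (# 2 , # 1 , # 0) ∷ (# 1 , # 2 , # 1) ∷ (# 3 , # 3 , # 1)
           ∷ (# 2 , # 4 , # 2) ∷ (# 3 , # 5 , # 2) ∷ []
  ; needsRowsApart = false ; needsColsApart = true }

unflagged : ∀ {a b c k} → Core a b c k → Flagged false false a b c k
unflagged K = record { core = K ; rows-apart = λ () ; cols-apart = λ () }

addRowPiece : ∀ {a b c k} → Core (suc a) b c k → Core (suc a) (1 + b) (2 + c) (2 + k)
addRowPiece = Flagged.core ∘ glue rowPiece (from-yes (GadgetConditions.valid? rowPiece)) (λ ()) (λ ()) ∘ unflagged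

addColPiece : ∀ {a b c k} → Core (suc a) b c k → Core (suc a) (2 + b) (1 + c) (2 + k)
addColPiece = Flagged.core ∘ glue colPiece (from-yes (GadgetConditions.valid? colPiece)) (λ ()) (λ ()) ∘ unflagged

addRowPieces₂ : ∀ {fc a b c k} → Flagged true fc (suc a) b c k → Flagged true fc (3 + a) (2 + b) (4 + c) (4 + k)
addRowPieces₂ = glue rowPieces₂ (from-yes (GadgetConditions.valid? rowPieces₂)) (λ t → t) (λ ())

addColPieces₂ : ∀ {fr a b c k} → Flagged fr true (suc a) b c k → Flagged fr true (3 + a) (4 + b) (2 + c) (4 + k)
addColPieces₂ = glue colPieces₂ (from-yes (GadgetConditions.valid? colPieces₂)) (λ ()) (λ t → t)

addRowPieces₃ : ∀ {fc a b c k} → Flagged true fc (suc a) b c k → Flagged true fc (4 + a) (3 + b) (6 + c) (6 + k)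
addRowPieces₃ = glue rowPieces₃ (from-yes (GadgetConditions.valid? rowPieces₃)) (λ t → t) (λ ())

addColPieces₃ : ∀ {fr a b c k} → Flagged fr true (suc a) b c k → Flagged fr true (4 + a) (6 + b) (3 + c) (6 + k)
addColPieces₃ = glue colPieces₃ (from-yes (GadgetConditions.valid? colPieces₃)) (λ ()) (λ t → t)

data Kernel : Set where
  k₁ k₂ k₃ : Kernel

side spare extra : Kernel → ℕ
side k₁ = 1
side k₂ = 2
side k₃ = 3
spare k₁ = 0
spare k₂ = 1
spare k₃ = 1
extra k₁ = 0
extra k₂ = 2
extra k₃ = 3

-- doubling by recursion, so that adding pieces changes rowsOf, colsOf and sizeOf
-- by literals up to definitional equality
twice : ℕ → ℕ
twice zero = zero
twice (suc n) = suc (suc (twice n))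

rowsOf colsOf sizeOf tightLayers : Kernel → ℕ → ℕ → ℕ
rowsOf κ i j = i + (twice j + side κ)
colsOf κ i j = twice i + (j + side κ)
sizeOf κ i j = twice (i + j) + extra κ
tightLayers κ i j = spare κ + (i + j)

-- Kernel k₁ with a single row piece gets no row flag, so from there row pieces are
-- added three at a time (likewise for columns).
rowsFlag colsFlag : Kernel → ℕ → Bool
rowsFlag k₁ 1 = false
rowsFlag _ _ = true
colsFlag k₁ 1 = false
colsFlag _ _ = true

CoreFor : Kernel → ℕ → ℕ → ℕ → Set
CoreFor κ i j a = Core a (rowsOf κ i j) (colsOf κ i j) (sizeOf κ i j)

TightCore : Kernel → ℕ → ℕ → Set
TightCore κ i j = Flagged (rowsFlag κ i) (colsFlag κ j) (tightLayers κ i j) (rowsOf κ i j) (colsOf κ i j) (sizeOf κ i j)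

-- b = c = 2: two distinct points cannot avoid both a row and a column
data Degenerate : Kernel → ℕ → ℕ → Set where
  k₂-origin : Degenerate k₂ 0 0

tightCore₁ : ∀ i j → TightCore k₁ i j
tightCore₁ (suc (suc (suc (suc i)))) j = addRowPieces₂ (tightCore₁ (suc (suc i)) j)
tightCore₁ 3 (suc j) = addRowPieces₃ (tightCore₁ 0 (suc j))
tightCore₁ 2 (suc j) = addRowPieces₂ (tightCore₁ 0 (suc j))
tightCore₁ 0 (suc (suc (suc (suc j)))) = addColPieces₂ (tightCore₁ 0 (suc (suc j)))
tightCore₁ 1 (suc (suc (suc (suc j)))) = addColPieces₂ (tightCore₁ 1 (suc (suc j)))
tightCore₁ 1 3 = addColPieces₃ (tightCore₁ 1 0)
tightCore₁ 1 2 = addColPieces₂ (tightCore₁ 1 0)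
tightCore₁ 3 0 = certified-core true true
  ((# 0 , # 1 , # 1) ∷ (# 1 , # 1 , # 2) ∷ (# 0 , # 2 , # 3) ∷ (# 2 , # 2 , # 4) ∷ (# 1 , # 3 , # 5) ∷ (# 2 , # 3 , # 6) ∷ [])
tightCore₁ 2 0 = certified-core true true ((# 0 , # 1 , # 1) ∷ (# 1 , # 1 , # 2) ∷ (# 0 , # 2 , # 3) ∷ (# 1 , # 2 , # 4) ∷ [])
tightCore₁ 0 3 = certified-core true true
  ((# 0 , # 1 , # 1) ∷ (# 1 , # 2 , # 1) ∷ (# 0 , # 3 , # 2) ∷ (# 2 , # 4 , # 2) ∷ (# 1 , # 5 , # 3) ∷ (# 2 , # 6 , # 3) ∷ [])
tightCore₁ 0 2 = certified-core true true ((# 0 , # 1 , # 1) ∷ (# 1 , # 2 , # 1) ∷ (# 0 , # 3 , # 2) ∷ (# 1 , # 4 , # 2) ∷ [])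
tightCore₁ 0 0 = certified-core true true []
tightCore₁ 0 1 = certified-core true false ((# 0 , # 1 , # 1) ∷ (# 0 , # 2 , # 1) ∷ [])
tightCore₁ 1 0 = certified-core false true ((# 0 , # 1 , # 1) ∷ (# 0 , # 1 , # 2) ∷ [])
tightCore₁ 1 1 = certified-core false false ((# 0 , # 1 , # 1) ∷ (# 1 , # 1 , # 2) ∷ (# 0 , # 2 , # 3) ∷ (# 0 , # 3 , # 3) ∷ [])

tightCore₂ : ∀ i j → ¬ Degenerate k₂ i j → TightCore k₂ i j
tightCore₂ (suc (suc i)) (suc j) _ = addRowPieces₂ (tightCore₂ i (suc j) λ ())
tightCore₂ (suc (suc (suc i))) 0 _ = addRowPieces₂ (tightCore₂ (suc i) 0 λ ())
tightCore₂ 0 (suc (suc (suc j))) _ = addColPieces₂ (tightCore₂ 0 (suc j) λ ())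
tightCore₂ 1 (suc (suc j)) _ = addColPieces₂ (tightCore₂ 1 j λ ())
tightCore₂ 2 0 _ = certified-core true true
  ((# 0 , # 1 , # 1) ∷ (# 1 , # 1 , # 2) ∷ (# 0 , # 2 , # 2) ∷ (# 1 , # 3 , # 3) ∷ (# 2 , # 3 , # 4) ∷ (# 2 , # 3 , # 5) ∷ [])
tightCore₂ 0 2 _ = certified-core true true
  ((# 0 , # 1 , # 1) ∷ (# 1 , # 1 , # 2) ∷ (# 0 , # 2 , # 2) ∷ (# 1 , # 3 , # 3) ∷ (# 2 , # 4 , # 3) ∷ (# 2 , # 5 , # 3) ∷ [])
tightCore₂ 0 0 nondegenerate = ⊥-elim (nondegenerate k₂-origin)
tightCore₂ 0 1 _ = certified-core true true ((# 0 , # 1 , # 1) ∷ (# 0 , # 2 , # 1) ∷ (# 1 , # 3 , # 1) ∷ (# 1 , # 1 , # 2) ∷ [])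
tightCore₂ 1 0 _ = certified-core true true ((# 0 , # 1 , # 1) ∷ (# 0 , # 1 , # 2) ∷ (# 1 , # 1 , # 3) ∷ (# 1 , # 2 , # 1) ∷ [])
tightCore₂ 1 1 _ = certified-core true true
  ((# 0 , # 1 , # 1) ∷ (# 0 , # 1 , # 2) ∷ (# 1 , # 1 , # 3) ∷ (# 1 , # 2 , # 4) ∷ (# 2 , # 3 , # 4) ∷ (# 2 , # 4 , # 4) ∷ [])

tightCore₃ : ∀ i j → TightCore k₃ i j
tightCore₃ (suc (suc i)) j = addRowPieces₂ (tightCore₃ i j)
tightCore₃ 0 (suc (suc j)) = addColPieces₂ (tightCore₃ 0 j)
tightCore₃ 1 (suc (suc j)) = addColPieces₂ (tightCore₃ 1 j)
tightCore₃ 0 0 = certified-core true true ((# 0 , # 1 , # 1) ∷ (# 0 , # 1 , # 2) ∷ (# 0 , # 2 , # 2) ∷ [])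
tightCore₃ 0 1 = certified-core true true
  ((# 0 , # 1 , # 1) ∷ (# 0 , # 2 , # 1) ∷ (# 0 , # 3 , # 2) ∷ (# 1 , # 3 , # 3) ∷ (# 0 , # 4 , # 3) ∷ [])
tightCore₃ 1 0 = certified-core true true
  ((# 0 , # 1 , # 1) ∷ (# 0 , # 2 , # 1) ∷ (# 0 , # 3 , # 2) ∷ (# 1 , # 3 , # 3) ∷ (# 1 , # 3 , # 4) ∷ [])
tightCore₃ 1 1 = certified-core true true
  ((# 0 , # 1 , # 1) ∷ (# 1 , # 2 , # 1) ∷ (# 0 , # 3 , # 2) ∷ (# 1 , # 4 , # 2) ∷ (# 0 , # 5 , # 3) ∷ (# 2 , # 5 , # 4) ∷ (# 2 , # 5 , # 5) ∷ [])

tightCore : ∀ κ i j → ¬ Degenerate κ i j → TightCore κ i j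
tightCore k₁ i j _ = tightCore₁ i j
tightCore k₂ i j nondegenerate = tightCore₂ i j nondegenerate
tightCore k₃ i j _ = tightCore₃ i j

m<n+suc[o]⇒m≤n+o : ∀ {m} n o → m < n + suc o → m ≤ n + o
m<n+suc[o]⇒m≤n+o {m} n o m< = ≤-pred (subst (suc m ≤_) (+-suc n o) m<)

coreFor : ∀ κ i j a → 1 ≤ a → a ≤ tightLayers κ i j → ¬ Degenerate κ i j → CoreFor κ i j a
looseCoreFor : ∀ κ i j a → 1 ≤ a → a < tightLayers κ i j → ¬ Degenerate κ i j → CoreFor κ i j a

coreFor κ i j a 1≤a a≤ nondegenerate with a ≟ℕ tightLayers κ i j
... | yes refl = Flagged.core (tightCore κ i j nondegenerate)
... | no a≢ = looseCoreFor κ i j a 1≤a (≤∧≢⇒< a≤ a≢) nondegenerate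

looseCoreFor κ (suc (suc i)) j (suc a) _ a< _ =
  addRowPiece (coreFor κ (suc i) j (suc a) (s≤s z≤n) (m<n+suc[o]⇒m≤n+o (spare κ) _ a<) λ ())
looseCoreFor κ 1 (suc j) (suc a) _ a< _ =
  addRowPiece (coreFor κ 0 (suc j) (suc a) (s≤s z≤n) (m<n+suc[o]⇒m≤n+o (spare κ) _ a<) λ ())
looseCoreFor k₁ 1 0 (suc a) _ (s≤s ()) _
looseCoreFor k₂ 1 0 1 _ _ _ =
  Flagged.core (certified-core false false ((# 0 , # 1 , # 1) ∷ (# 0 , # 1 , # 2) ∷ (# 0 , # 1 , # 3) ∷ (# 0 , # 2 , # 1) ∷ []))
looseCoreFor k₂ 1 0 (suc (suc a)) _ (s≤s (s≤s ())) _
looseCoreFor k₃ 1 0 (suc a) _ a< _ =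
  addRowPiece (coreFor k₃ 0 0 (suc a) (s≤s z≤n) (m<n+suc[o]⇒m≤n+o 1 0 a<) λ ())
looseCoreFor κ 0 (suc (suc j)) (suc a) _ a< _ =
  addColPiece (coreFor κ 0 (suc j) (suc a) (s≤s z≤n) (m<n+suc[o]⇒m≤n+o (spare κ) _ a<) λ ())
looseCoreFor k₁ 0 1 (suc a) _ (s≤s ()) _
looseCoreFor k₂ 0 1 1 _ _ _ =
  Flagged.core (certified-core false false ((# 0 , # 1 , # 1) ∷ (# 0 , # 2 , # 1) ∷ (# 0 , # 3 , # 1) ∷ (# 0 , # 1 , # 2) ∷ []))
looseCoreFor k₂ 0 1 (suc (suc a)) _ (s≤s (s≤s ())) _
looseCoreFor k₃ 0 1 (suc a) _ a< _ =
  addColPiece (coreFor k₃ 0 0 (suc a) (s≤s z≤n) (m<n+suc[o]⇒m≤n+o 1 0 a<) λ ())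
looseCoreFor k₁ 0 0 _ _ () _
looseCoreFor k₂ 0 0 _ _ _ nondegenerate = ⊥-elim (nondegenerate k₂-origin)
looseCoreFor k₃ 0 0 (suc a) _ (s≤s ()) _

twice≡2* : ∀ n → twice n ≡ 2 * n
twice≡2* zero = refl
twice≡2* (suc n) = trans (cong (2 +_) (twice≡2* n)) (sym (*-suc 2 n))

residue : ∀ m → 1 ≤ m → ∃₂ λ κ j → m ≡ j + (twice j + side κ)
residue 1 _ = k₁ , 0 , refl
residue 2 _ = k₂ , 0 , refl
residue 3 _ = k₃ , 0 , refl
residue (suc (suc (suc (suc m)))) _ with residue (suc m) (s≤s z≤n)
... | κ , j , eq = κ , suc j ,
  trans (cong (3 +_) eq) (cong suc (sym (trans (+-suc j _) (cong suc (+-suc j _)))))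

colsOf≡rowsOf+d : ∀ κ d j → colsOf κ (d + j) j ≡ rowsOf κ (d + j) j + d
colsOf≡rowsOf+d κ d j = begin
  twice (d + j) + (j + side κ)          ≡⟨ cong (_+ (j + side κ)) (twice≡2* (d + j)) ⟩
  2 * (d + j) + (j + side κ)            ≡⟨ identity d j (side κ) ⟩
  d + j + (2 * j + side κ) + d          ≡⟨ cong (λ x → d + j + (x + side κ) + d) (sym (twice≡2* j)) ⟩
  d + j + (twice j + side κ) + d        ∎
  where
  open ≡-Reasoning
  identity : ∀ d j s → 2 * (d + j) + (j + s) ≡ d + j + (2 * j + s) + d
  identity = solve-∀

decompose : ∀ {b c} → b ≤ c → c < 2 * b → ∃₂ λ κ i → ∃ λ j → b ≡ rowsOf κ i j × c ≡ colsOf κ i j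
decompose {b} {c} b≤c c<2b = κ , d + j , j , b≡rows , c≡cols
  where
  open ≡-Reasoning
  d = c ∸ b
  c≡b+d : c ≡ b + d
  c≡b+d = sym (m+[n∸m]≡n b≤c)
  d<b : d < b
  d<b = +-cancelˡ-< b d b (subst₂ _<_ c≡b+d (cong (b +_) (+-identityʳ b)) c<2b)
  r = residue (b ∸ d) (m<n⇒0<n∸m d<b)
  κ = proj₁ r
  j = proj₁ (proj₂ r)
  b≡rows : b ≡ rowsOf κ (d + j) j
  b≡rows = begin
    b                              ≡⟨ sym (m+[n∸m]≡n (<⇒≤ d<b)) ⟩
    d + (b ∸ d)                    ≡⟨ cong (d +_) (proj₂ (proj₂ r)) ⟩
    d + (j + (twice j + side κ))   ≡⟨ sym (+-assoc d j _) ⟩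
    d + j + (twice j + side κ)     ∎
  c≡cols : c ≡ colsOf κ (d + j) j
  c≡cols = trans c≡b+d (trans (cong (_+ d) b≡rows) (sym (colsOf≡rowsOf+d κ d j)))

rowsOf+colsOf : ∀ κ i j → rowsOf κ i j + colsOf κ i j ≡ 3 * (i + j) + 2 * side κ
rowsOf+colsOf κ i j = begin
  i + (twice j + side κ) + (twice i + (j + side κ))  ≡⟨ cong₂ (λ x y → i + (x + side κ) + (y + (j + side κ))) (twice≡2* j) (twice≡2* i) ⟩
  i + (2 * j + side κ) + (2 * i + (j + side κ))      ≡⟨ identity i j (side κ) ⟩
  3 * (i + j) + 2 * side κ                           ∎
  where
  open ≡-Reasoning
  identity : ∀ i j s → i + (2 * j + s) + (2 * i + (j + s)) ≡ 3 * (i + j) + 2 * s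
  identity = solve-∀

3a<b+c⇒a≤tightLayers : ∀ κ i j {a} → 3 * a < rowsOf κ i j + colsOf κ i j → a ≤ tightLayers κ i j
3a<b+c⇒a≤tightLayers κ i j {a} 3a< = ≤-pred (*-cancelˡ-< 3 a (suc (spare κ + (i + j))) (begin-strict
  3 * a                                  <⟨ 3a< ⟩
  rowsOf κ i j + colsOf κ i j            ≡⟨ rowsOf+colsOf κ i j ⟩
  3 * (i + j) + 2 * side κ               ≤⟨ +-monoʳ-≤ (3 * (i + j)) (two-sides κ) ⟩
  3 * (i + j) + 3 * suc (spare κ)        ≡⟨ identity (i + j) (spare κ) ⟩
  3 * suc (spare κ + (i + j))            ∎))
  where
  open ≤-Reasoning
  two-sides : ∀ κ → 2 * side κ ≤ 3 * suc (spare κ)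
  two-sides k₁ = s≤s (s≤s z≤n)
  two-sides k₂ = s≤s (s≤s (s≤s (s≤s z≤n)))
  two-sides k₃ = ≤-refl
  identity : ∀ n s → 3 * n + 3 * suc s ≡ 3 * suc (s + n)
  identity = solve-∀

[r+m*3]/3≡m : ∀ {r} m → r < 3 → (r + m * 3) / 3 ≡ m
[r+m*3]/3≡m {r} m r<3 = begin
  (r + m * 3) / 3       ≡⟨ +-distrib-/ r (m * 3) remainders<3 ⟩
  r / 3 + m * 3 / 3     ≡⟨ cong₂ _+_ (m<n⇒m/n≡0 r<3) (m*n/n≡m m 3) ⟩
  m                     ∎
  where
  open ≡-Reasoning
  remainders<3 : r % 3 + m * 3 % 3 < 3
  remainders<3 = subst₂ (λ u v → u + v < 3) (sym (m<n⇒m%n≡m r<3)) (sym (m*n%n≡0 m 3))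
                        (subst (_< 3) (sym (+-identityʳ r)) r<3)

[2*[b+c∸1]]/3≡sizeOf : ∀ κ i j → (2 * (rowsOf κ i j + colsOf κ i j ∸ 1)) / 3 ≡ sizeOf κ i j
[2*[b+c∸1]]/3≡sizeOf κ i j = begin
  (2 * (rowsOf κ i j + colsOf κ i j ∸ 1)) / 3       ≡⟨ cong (λ m → (2 * (m ∸ 1)) / 3) (rowsOf+colsOf κ i j) ⟩
  (2 * (3 * n + 2 * side κ ∸ 1)) / 3            ≡⟨ cong (λ m → (2 * m) / 3) (+-∸-assoc (3 * n) (1≤2*side κ)) ⟩
  (2 * (3 * n + (2 * side κ ∸ 1))) / 3          ≡⟨ cong (_/ 3) (expand κ) ⟩
  (remainder κ + (2 * n + extra κ) * 3) / 3     ≡⟨ [r+m*3]/3≡m (2 * n + extra κ) (remainder<3 κ) ⟩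
  2 * n + extra κ                               ≡⟨ cong (_+ extra κ) (sym (twice≡2* n)) ⟩
  twice n + extra κ                             ∎
  where
  open ≡-Reasoning
  n = i + j
  1≤2*side : ∀ κ → 1 ≤ 2 * side κ
  1≤2*side k₁ = s≤s z≤n
  1≤2*side k₂ = s≤s z≤n
  1≤2*side k₃ = s≤s z≤n
  remainder : Kernel → ℕ
  remainder k₁ = 2
  remainder k₂ = 0
  remainder k₃ = 1
  remainder<3 : ∀ κ → remainder κ < 3
  remainder<3 k₁ = s≤s (s≤s (s≤s z≤n))
  remainder<3 k₂ = s≤s z≤n
  remainder<3 k₃ = s≤s (s≤s z≤n)
  expand₁ : ∀ n → 2 * (3 * n + 1) ≡ 2 + (2 * n + 0) * 3
  expand₁ = solve-∀
  expand₂ : ∀ n → 2 * (3 * n + 3) ≡ 0 + (2 * n + 2) * 3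
  expand₂ = solve-∀
  expand₃ : ∀ n → 2 * (3 * n + 5) ≡ 1 + (2 * n + 3) * 3
  expand₃ = solve-∀
  expand : ∀ κ → 2 * (3 * n + (2 * side κ ∸ 1)) ≡ remainder κ + (2 * n + extra κ) * 3
  expand k₁ = expand₁ n
  expand k₂ = expand₂ n
  expand k₃ = expand₃ n

degenerate? : ∀ κ i j → Dec (Degenerate κ i j)
degenerate? k₂ zero zero = yes k₂-origin
degenerate? k₂ zero (suc j) = no λ ()
degenerate? k₂ (suc i) j = no λ ()
degenerate? k₁ i j = no λ ()
degenerate? k₃ i j = no λ ()

ResolvingSetOfSize : ∀ a b c → ℕ → Set
ResolvingSetOfSize a b c k = ∃ λ (Q : List (Vertex a b c)) → Unique Q × Resolving Q × length Q ≡ k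

upper-bound : ∀ {a} κ i j → 1 ≤ a → 3 * a < rowsOf κ i j + colsOf κ i j →
              ResolvingSetOfSize a (rowsOf κ i j) (colsOf κ i j) ((2 * (rowsOf κ i j + colsOf κ i j ∸ 1)) / 3)
upper-bound κ i j 1≤a 3a< with degenerate? κ i j
... | no nondegenerate = points , unique , resolving , trans size (sym ([2*[b+c∸1]]/3≡sizeOf κ i j))
  where open Core (coreFor κ i j _ 1≤a (3a<b+c⇒a≤tightLayers κ i j 3a<) nondegenerate)
... | yes k₂-origin with ≤-antisym (3a<b+c⇒a≤tightLayers k₂ 0 0 3a<) 1≤a
... | refl = Q , from-yes (unique? Q) , from-yes (resolving? Q) , refl
  where
  Q : List (Vertex 1 2 2)
  Q = (# 0 , # 0 , # 0) ∷ (# 0 , # 0 , # 1) ∷ []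

theorem7 : (a b c : ℕ) → 1 ≤ a → a ≤ b → b ≤ c → 3 * a < b + c → c < 2 * b →
    MetricDimEq a b c ((2 * (b + c ∸ 1)) / 3)
theorem7 a b c 1≤a a≤b b≤c 3a<b+c c<2b with decompose b≤c c<2b
... | κ , i , j , refl , refl = upper-bound κ i j 1≤a 3a<b+c , λ _ _ → lower-bound vertex
  where
  vertex : Vertex a (rowsOf κ i j) (colsOf κ i j)
  vertex = fromℕ< 1≤a , fromℕ< (≤-trans 1≤a a≤b) , fromℕ< (≤-trans 1≤a (≤-trans a≤b b≤c))
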